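{- Let $\Delta$ be a positive integer and let $A\subseteq\mathbb{Z}^2$ be a $\Delta$-modular point set, and let $Q_A=\operatorname{conv}(A\cup(-A))$. Then the lattice-width of $Q_A$ satisfies $\omega_L(Q_A)\leq\sqrt{2\pi}\sqrt{\Delta}$.
   Context: A finite set $A\subseteq\mathbb{Z}^2$ is identified with the integer matrix whose columns are its elements; it is $\Delta$-modular if this matrix has rank $2$ and the maximum of $|\det(a_1,a_2)|$ over $a_1,a_2\in A$ equals $\Delta$. For a convex body $K\subseteq\mathbb{R}^2$ and $v\in\mathbb{R}^2\setminus\{0\}$, the width is $\omega(K,v)=\max_{x\in K}x^\intercal v-\min_{x\in K}x^\intercal v$, and the lattice-width is $\omega_L(K)=\min_{v\in\mathbb{Z}^2\setminus\{0\}}\omega(K,v)$. -}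

module Defs where

open import Data.Nat as ℕ using (ℕ; zero; suc)
open import Data.Integer as ℤ using (ℤ; +_; ∣_∣)
open import Data.Rational as ℚ using (ℚ; 0ℚ; 1ℚ)
open import Data.Fin using (Fin; splitAt)
open import Data.Sum using (inj₁; inj₂)
open import Data.Product using (_×_; _,_; proj₁; proj₂; Σ; ∃; ∃₂)
open import Relation.Binary.PropositionalEquality using (_≡_; _≢_)

ℤ² : Set
ℤ² = ℤ × ℤ

ℚ² : Set
ℚ² = ℚ × ℚ

-- A finite point set A ⊆ ℤ², given as the columns a₀ … a_{n-1} of an
-- integer 2×n matrix.
PointSet : ℕ → Set
PointSet n = Fin n → ℤ²

det : ℤ² → ℤ² → ℤ
det (a₁ , a₂) (b₁ , b₂) = a₁ ℤ.* b₂ ℤ.- a₂ ℤ.* b₁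

-- rank of the 2×n matrix is 2 iff some 2×2 minor (pair of columns) is nonzero
Rank2 : ∀ {n} → PointSet n → Set
Rank2 A = ∃₂ λ i j → det (A i) (A j) ≢ + 0

IsModular : ∀ {n} → PointSet n → ℕ → Set
IsModular A Δ =
  Rank2 A
  × (∃₂ λ i j → ∣ det (A i) (A j) ∣ ≡ Δ)
  × (∀ i j → ∣ det (A i) (A j) ∣ ℕ.≤ Δ)

symm : ∀ {n} → PointSet n → PointSet (n ℕ.+ n)
symm {n} A k with splitAt n k
... | inj₁ i = A i
... | inj₂ i = ℤ.- proj₁ (A i) , ℤ.- proj₂ (A i)

sumℚ : ∀ {m} → (Fin m → ℚ) → ℚ
sumℚ {zero} f = 0ℚ
sumℚ {suc m} f = f Fin.zero ℚ.+ sumℚ (λ i → f (Fin.suc i))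

ι : ℤ → ℚ
ι z = z ℚ./ 1

InConv : ∀ {m} → (Fin m → ℤ²) → ℚ² → Set
InConv {m} S (x₁ , x₂) =
  Σ (Fin m → ℚ) λ λs →
      (∀ i → 0ℚ ℚ.≤ λs i)
    × (sumℚ λs ≡ 1ℚ)
    × (x₁ ≡ sumℚ (λ i → λs i ℚ.* ι (proj₁ (S i))))
    × (x₂ ≡ sumℚ (λ i → λs i ℚ.* ι (proj₂ (S i))))

dot : ℚ² → ℤ² → ℚ
dot (x₁ , x₂) (v₁ , v₂) = x₁ ℚ.* ι v₁ ℚ.+ x₂ ℚ.* ι v₂

leibnizTerm : ℕ → ℚ
leibnizTerm k with k ℕ.% 2
... | zero  = + 4 ℚ./ suc (2 ℕ.* k)
... | suc _ = ℚ.- (+ 4 ℚ./ suc (2 ℕ.* k))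

leibniz : ℕ → ℚ
leibniz zero = 0ℚ
leibniz (suc m) = leibniz m ℚ.+ leibnizTerm m

-- Upper bounds of π: partial sums with an odd number of terms,
-- piUpper n = leibniz (2n+1); they decrease strictly to π, so π = inf_n piUpper n.
piUpper : ℕ → ℚ
piUpper n = leibniz (suc (2 ℕ.* n))

-- q ≤ π · r  (for r > 0), i.e. q ≤ piUpper n · r for every n.
_≤π·_ : ℚ → ℚ → Set
q ≤π· r = ∀ n → q ℚ.≤ piUpper n ℚ.* r

-- ω_L(conv(A ∪ -A)) ≤ √(2π)·√Δ, written out:
-- there is v ∈ ℤ² \ {0} with ω(Q_A, v) ≤ √(2πΔ), i.e. for all x, y ∈ Q_A,
-- (xᵀv - yᵀv)² ≤ 2πΔ.
LatticeWidthBound : ∀ {n} → PointSet n → ℕ → Set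
LatticeWidthBound A Δ =
  Σ ℤ² λ v → v ≢ (+ 0 , + 0) ×
    (∀ x y → InConv (symm A) x → InConv (symm A) y →
      let d = dot x v ℚ.- dot y v in
      (d ℚ.* d) ≤π· ι (+ (2 ℕ.* Δ)))

-- Let N u = max_i |det (a_i , u)|, half the width of Q_A in the direction perp u, and take
-- a Lagrange-Gauss reduced unimodular basis u₁ , u₂ for N: N u₁ ≤ N u₂ ≤ N (u₂ ± u₁).
-- Write m = N u₁ and μ = N u₂. The map x ↦ (det (x , u₁) , det (x , u₂)) preserves |det|,
-- and sends ±A into the box [-m , m] × [-μ , μ], touching its sides x = ±m and y = ±μ
-- and the lines y ∓ x = ±μ. A case analysis on four touching points finds two whose
-- |det| is at least 2m²/3; its heart is that the products p q, w (m - p) and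
-- (m - w) (m - q) cannot all exceed m²/3, as their product is at most (m²/4)³.
-- So 2m² ≤ 3Δ, and the width 2m in direction perp u₁ satisfies (2m)² ≤ 6Δ ≤ 2πΔ,
-- where π ≥ 3 because every Leibniz upper bound piUpper n is at least 3.
module Submission where

open import Defs
open import Data.Nat.Base as ℕ
  using (ℕ; zero; suc; NonZero; _+_; _*_; _∸_; _≤_; _<_; z≤n; s≤s)
import Data.Nat.Properties as ℕ
open import Data.Nat.DivMod using (_%_; [m+kn]%n≡m%n)
open import Data.Nat.Tactic.RingSolver using (solve-∀)
open import Data.Integer.Base as ℤ using (ℤ; +_; -[1+_]; +[1+_]; ∣_∣; _⊖_; +≤+)
import Data.Integer.Properties as ℤ
open import Data.Integer.Tactic.RingSolver using () renaming (solve-∀ to ℤ-solve-∀)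
open import Data.Rational.Base as ℚ using (ℚ; 0ℚ; 1ℚ; toℚᵘ)
import Data.Rational.Properties as ℚ
open import Data.Rational.Unnormalised.Base as ℚᵘ using (mkℚᵘ; *≡*; *≤*)
import Data.Rational.Unnormalised.Properties as ℚᵘ
open import Data.Rational.Solver using (module +-*-Solver)
open import Data.Fin.Base using (Fin; splitAt) renaming (zero to fzero; suc to fsuc)
open import Data.List.Base using (allFin)
open import Data.List.Extrema ℕ.≤-totalOrder using (argmax; f[xs]≤f[argmax])
import Data.List.Relation.Unary.All as All
open import Data.List.Membership.Propositional.Properties using (∈-allFin)
open import Data.Empty using (⊥)
open import Data.Product using (_×_; _,_; proj₁; proj₂; ∃; ∃₂)
open import Data.Sum using (_⊎_; inj₁; inj₂; [_,_]′)
open import Relation.Nullary using (yes; no; contradiction)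
open import Relation.Binary.PropositionalEquality

4*mn≤[m+n]² : ∀ m n → 4 * (m * n) ≤ (m + n) * (m + n)
4*mn≤[m+n]² m n = [ ordered , swapped ]′ (ℕ.≤-total m n)
  where
  ordered : ∀ {m n} → m ≤ n → 4 * (m * n) ≤ (m + n) * (m + n)
  ordered {m} m≤n with ℕ.m≤n⇒∃[o]m+o≡n m≤n
  ... | k , refl = ℕ.≤-trans (ℕ.m≤m+n _ (k * k)) (ℕ.≤-reflexive (square m k))
    where
    square : ∀ m k → 4 * (m * (m + k)) + k * k ≡ (m + (m + k)) * (m + (m + k))
    square = solve-∀
  swapped : n ≤ m → 4 * (m * n) ≤ (m + n) * (m + n)
  swapped n≤m = subst₂ (λ x y → 4 * x ≤ y * y) (ℕ.*-comm n m) (ℕ.+-comm n m) (ordered n≤m)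

-- If all three products exceeded m²/3, their product would exceed m⁶/27,
-- whereas by AM-GM it is at most (m²/4)³.
cyclic-products-not-all-large : ∀ {m p p′ q q′ w w′} →
  p + p′ ≡ m → q + q′ ≡ m → w + w′ ≡ m →
  m * m < 3 * (p * q) → m * m < 3 * (w * p′) → m * m < 3 * (w′ * q′) → ⊥
cyclic-products-not-all-large {m} {p} {p′} {q} {q′} {w} {w′} p+p′≡m q+q′≡m w+w′≡m pq wp′ w′q′ =
  ℕ.<-irrefl refl (ℕ.<-≤-trans M³<27X (ℕ.≤-trans 27X≤64X 64X≤M³))
  where
  M = m * m
  X = (p * p′) * (q * q′) * (w * w′)
  M³<27X : M * M * M < 27 * X
  M³<27X = subst (M * M * M <_) (product p p′ q q′ w w′) (ℕ.*-mono-< (ℕ.*-mono-< pq wp′) w′q′)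
    where
    product : ∀ p p′ q q′ w w′ →
      3 * (p * q) * (3 * (w * p′)) * (3 * (w′ * q′)) ≡ 27 * ((p * p′) * (q * q′) * (w * w′))
    product = solve-∀
  27X≤64X : 27 * X ≤ 64 * X
  27X≤64X = ℕ.*-monoˡ-≤ X (ℕ.m≤m+n 27 37)
  amgm : ∀ x y → x + y ≡ m → 4 * (x * y) ≤ M
  amgm x y x+y≡m = subst (λ z → 4 * (x * y) ≤ z * z) x+y≡m (4*mn≤[m+n]² x y)
  64X≤M³ : 64 * X ≤ M * M * M
  64X≤M³ = subst (_≤ M * M * M) (product p p′ q q′ w w′)
    (ℕ.*-mono-≤ (ℕ.*-mono-≤ (amgm p p′ p+p′≡m) (amgm q q′ q+q′≡m)) (amgm w w′ w+w′≡m))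
    where
    product : ∀ p p′ q q′ w w′ →
      4 * (p * p′) * (4 * (q * q′)) * (4 * (w * w′)) ≡ 64 * ((p * p′) * (q * q′) * (w * w′))
    product = solve-∀

some-cyclic-product≤m²/3 : ∀ {m p p′ q q′ w w′} →
  p + p′ ≡ m → q + q′ ≡ m → w + w′ ≡ m →
  3 * (p * q) ≤ m * m ⊎ 3 * (w * p′) ≤ m * m ⊎ 3 * (w′ * q′) ≤ m * m
some-cyclic-product≤m²/3 {m} {p} {p′} {q} {q′} {w} {w′} ep eq ew
  with 3 * (p * q) ℕ.≤? m * m | 3 * (w * p′) ℕ.≤? m * m | 3 * (w′ * q′) ℕ.≤? m * m
... | yes h | _     | _     = inj₁ h
... | no _  | yes h | _     = inj₂ (inj₁ h)
... | no _  | no _  | yes h = inj₂ (inj₂ h)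
... | no h₁ | no h₂ | no h₃ =
  contradiction (ℕ.≰⇒> h₃)
    (cyclic-products-not-all-large {m} {p} {p′} {q} {q′} {w} {w′} ep eq ew (ℕ.≰⇒> h₁) (ℕ.≰⇒> h₂))

M≤x+y⇒3y≤M⇒2M≤3x : ∀ {M} x y → M ≤ x + y → 3 * y ≤ M → 2 * M ≤ 3 * x
M≤x+y⇒3y≤M⇒2M≤3x {M} x y M≤x+y 3y≤M = ℕ.+-cancelʳ-≤ (3 * y) (2 * M) (3 * x) (begin
  2 * M + 3 * y   ≤⟨ ℕ.+-monoʳ-≤ (2 * M) 3y≤M ⟩
  2 * M + M       ≡⟨ ℕ.+-comm (2 * M) M ⟩
  3 * M           ≤⟨ ℕ.*-monoʳ-≤ 3 M≤x+y ⟩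
  3 * (x + y)     ≡⟨ ℕ.*-distribˡ-+ 3 x y ⟩
  3 * x + 3 * y   ∎)
  where open ℕ.≤-Reasoning

-- The three bounded quantities are the |det| of the pairs among (m , P), (Q , μ) and (-W , Y).
three-point-bound-ℕ : ∀ {Δ m μ P Q W Y} → m ≤ μ → P ≤ μ → Q ≤ m → W ≤ m → μ ≤ Y + W →
  m * μ ∸ P * Q ≤ Δ → m * Y + P * W ≤ Δ → Q * Y + μ * W ≤ Δ → 2 * (m * m) ≤ 3 * Δ
three-point-bound-ℕ {Δ} {m} {μ} {P} {Q} {W} {Y} m≤μ P≤μ Q≤m W≤m μ≤Y+W ab ac bc with P ℕ.≤? m
... | no P≰m =
  ℕ.≤-trans (ℕ.*-monoˡ-≤ (m * m) (ℕ.m≤m+n 2 1)) (ℕ.*-monoʳ-≤ 3 (ℕ.≤-trans m²≤mY+PW ac))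
  where
  m²≤mY+PW : m * m ≤ m * Y + P * W
  m²≤mY+PW = begin
    m * m           ≤⟨ ℕ.*-monoʳ-≤ m (ℕ.≤-trans m≤μ μ≤Y+W) ⟩
    m * (Y + W)     ≡⟨ ℕ.*-distribˡ-+ m Y W ⟩
    m * Y + m * W   ≤⟨ ℕ.+-monoʳ-≤ (m * Y) (ℕ.*-monoˡ-≤ W (ℕ.<⇒≤ (ℕ.≰⇒> P≰m))) ⟩
    m * Y + P * W   ∎
    where open ℕ.≤-Reasoning
... | yes P≤m
  with some-cyclic-product≤m²/3 {m} {P} {m ∸ P} {Q} {m ∸ Q} {W} {m ∸ W}
         (ℕ.m+[n∸m]≡n P≤m) (ℕ.m+[n∸m]≡n Q≤m) (ℕ.m+[n∸m]≡n W≤m)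
... | inj₁ 3PQ≤m² =
  ℕ.≤-trans (M≤x+y⇒3y≤M⇒2M≤3x _ (P * Q) m²≤ab+PQ 3PQ≤m²) (ℕ.*-monoʳ-≤ 3 ab)
  where
  m²≤ab+PQ : m * m ≤ (m * μ ∸ P * Q) + P * Q
  m²≤ab+PQ = ℕ.≤-trans (ℕ.*-monoʳ-≤ m m≤μ)
    (ℕ.≤-reflexive (sym (ℕ.m∸n+n≡m (subst (P * Q ≤_) (ℕ.*-comm μ m) (ℕ.*-mono-≤ P≤μ Q≤m)))))
... | inj₂ (inj₁ 3WP′≤m²) =
  ℕ.≤-trans (M≤x+y⇒3y≤M⇒2M≤3x _ (W * (m ∸ P)) m²≤ac+WP′ 3WP′≤m²) (ℕ.*-monoʳ-≤ 3 ac)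
  where
  m²≤ac+WP′ : m * m ≤ (m * Y + P * W) + W * (m ∸ P)
  m²≤ac+WP′ = begin
    m * m                             ≤⟨ ℕ.*-monoʳ-≤ m (ℕ.≤-trans m≤μ μ≤Y+W) ⟩
    m * (Y + W)                       ≡⟨ ℕ.*-distribˡ-+ m Y W ⟩
    m * Y + m * W                     ≡⟨ cong (λ x → m * Y + x * W) (ℕ.m+[n∸m]≡n P≤m) ⟨
    m * Y + (P + (m ∸ P)) * W         ≡⟨ regroup m Y P W (m ∸ P) ⟩
    (m * Y + P * W) + W * (m ∸ P)     ∎
    where
    open ℕ.≤-Reasoning
    regroup : ∀ m Y P W P′ → m * Y + (P + P′) * W ≡ (m * Y + P * W) + W * P′
    regroup = solve-∀
... | inj₂ (inj₂ 3W′Q′≤m²) =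
  ℕ.≤-trans (M≤x+y⇒3y≤M⇒2M≤3x _ ((m ∸ W) * (m ∸ Q)) m²≤bc+W′Q′ 3W′Q′≤m²) (ℕ.*-monoʳ-≤ 3 bc)
  where
  m∸W≤Y : m ∸ W ≤ Y
  m∸W≤Y = ℕ.≤-trans (ℕ.∸-monoˡ-≤ W (ℕ.≤-trans m≤μ μ≤Y+W)) (ℕ.≤-reflexive (ℕ.m+n∸n≡m Y W))
  m²≤bc+W′Q′ : m * m ≤ (Q * Y + μ * W) + (m ∸ W) * (m ∸ Q)
  m²≤bc+W′Q′ = begin
    m * m
      ≡⟨ expand Q (m ∸ Q) W (m ∸ W) (ℕ.m+[n∸m]≡n Q≤m) (ℕ.m+[n∸m]≡n W≤m) ⟨
    Q * (m ∸ W) + m * W + (m ∸ W) * (m ∸ Q)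
      ≤⟨ ℕ.+-monoˡ-≤ _ (ℕ.+-mono-≤ (ℕ.*-monoʳ-≤ Q m∸W≤Y) (ℕ.*-monoˡ-≤ W m≤μ)) ⟩
    (Q * Y + μ * W) + (m ∸ W) * (m ∸ Q)
      ∎
    where
    open ℕ.≤-Reasoning
    expand : ∀ {m} Q Q′ W W′ → Q + Q′ ≡ m → W + W′ ≡ m → Q * W′ + m * W + W′ * Q′ ≡ m * m
    expand Q Q′ W W′ refl W+W′≡m =
      trans (square Q Q′ W W′) (cong ((Q + Q′) *_) W+W′≡m)
      where
      square : ∀ Q Q′ W W′ → Q * W′ + (Q + Q′) * W + W′ * Q′ ≡ (Q + Q′) * (W + W′)
      square = solve-∀

-ᵛ_ : ℤ² → ℤ²
-ᵛ x = ℤ.- proj₁ x , ℤ.- proj₂ x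

-ᵛ-involutive : ∀ x → -ᵛ -ᵛ x ≡ x
-ᵛ-involutive (x₁ , x₂) = cong₂ _,_ (ℤ.neg-involutive x₁) (ℤ.neg-involutive x₂)

_+ᵛ_ _-ᵛ_ : ℤ² → ℤ² → ℤ²
x +ᵛ y = proj₁ x ℤ.+ proj₁ y , proj₂ x ℤ.+ proj₂ y
x -ᵛ y = proj₁ x ℤ.- proj₁ y , proj₂ x ℤ.- proj₂ y

reflect : ℤ² → ℤ²
reflect x = proj₁ x , ℤ.- proj₂ x

det-negˡ : ∀ x y → det (-ᵛ x) y ≡ ℤ.- det x y
det-negˡ (a , b) (c , d) = identity a b c d
  where
  identity : ∀ a b c d → ℤ.- a ℤ.* d ℤ.- ℤ.- b ℤ.* c ≡ ℤ.- (a ℤ.* d ℤ.- b ℤ.* c)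
  identity = ℤ-solve-∀

det-negʳ : ∀ x y → det x (-ᵛ y) ≡ ℤ.- det x y
det-negʳ (a , b) (c , d) = identity a b c d
  where
  identity : ∀ a b c d → a ℤ.* ℤ.- d ℤ.- b ℤ.* ℤ.- c ≡ ℤ.- (a ℤ.* d ℤ.- b ℤ.* c)
  identity = ℤ-solve-∀

det-reflect : ∀ x y → det (reflect x) (reflect y) ≡ ℤ.- det x y
det-reflect (a , b) (c , d) = identity a b c d
  where
  identity : ∀ a b c d → a ℤ.* ℤ.- d ℤ.- ℤ.- b ℤ.* c ≡ ℤ.- (a ℤ.* d ℤ.- b ℤ.* c)
  identity = ℤ-solve-∀

det-+ʳ : ∀ x u w → det x (u +ᵛ w) ≡ det x u ℤ.+ det x w
det-+ʳ (a , b) (c , d) (e , f) = identity a b c d e f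
  where
  identity : ∀ a b c d e f →
    a ℤ.* (d ℤ.+ f) ℤ.- b ℤ.* (c ℤ.+ e) ≡ (a ℤ.* d ℤ.- b ℤ.* c) ℤ.+ (a ℤ.* f ℤ.- b ℤ.* e)
  identity = ℤ-solve-∀

det--ʳ : ∀ x u w → det x (u -ᵛ w) ≡ det x u ℤ.- det x w
det--ʳ (a , b) (c , d) (e , f) = identity a b c d e f
  where
  identity : ∀ a b c d e f →
    a ℤ.* (d ℤ.- f) ℤ.- b ℤ.* (c ℤ.- e) ≡ (a ℤ.* d ℤ.- b ℤ.* c) ℤ.- (a ℤ.* f ℤ.- b ℤ.* e)
  identity = ℤ-solve-∀

det-+ˡ-self : ∀ u w → det u (w +ᵛ u) ≡ det u w
det-+ˡ-self (a , b) (c , d) = identity a b c d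
  where
  identity : ∀ a b c d → a ℤ.* (d ℤ.+ b) ℤ.- b ℤ.* (c ℤ.+ a) ≡ a ℤ.* d ℤ.- b ℤ.* c
  identity = ℤ-solve-∀

det--ˡ-self : ∀ u w → det u (w -ᵛ u) ≡ det u w
det--ˡ-self (a , b) (c , d) = identity a b c d
  where
  identity : ∀ a b c d → a ℤ.* (d ℤ.- b) ℤ.- b ℤ.* (c ℤ.- a) ≡ a ℤ.* d ℤ.- b ℤ.* c
  identity = ℤ-solve-∀

det-comm : ∀ u w → det w u ≡ ℤ.- det u w
det-comm (a , b) (c , d) = identity a b c d
  where
  identity : ∀ a b c d → c ℤ.* b ℤ.- d ℤ.* a ≡ ℤ.- (a ℤ.* d ℤ.- b ℤ.* c)
  identity = ℤ-solve-∀

coordinates : ℤ² → ℤ² → ℤ² → ℤ²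
coordinates u w x = det x u , det x w

det-coordinates : ∀ u w x y →
  det (coordinates u w x) (coordinates u w y) ≡ det x y ℤ.* det u w
det-coordinates (e , f) (g , h) (a , b) (c , d) = identity a b c d e f g h
  where
  identity : ∀ a b c d e f g h →
    (a ℤ.* f ℤ.- b ℤ.* e) ℤ.* (c ℤ.* h ℤ.- d ℤ.* g) ℤ.- (a ℤ.* h ℤ.- b ℤ.* g) ℤ.* (c ℤ.* f ℤ.- d ℤ.* e)
      ≡ (a ℤ.* d ℤ.- b ℤ.* c) ℤ.* (e ℤ.* h ℤ.- f ℤ.* g)
  identity = ℤ-solve-∀

∣-i∣≡∣j∣ : ∀ {i j} → i ≡ ℤ.- j → ∣ i ∣ ≡ ∣ j ∣
∣-i∣≡∣j∣ {j = j} refl = ℤ.∣-i∣≡∣i∣ j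

det-I-II : ∀ a b c d → det (+ a , + b) (ℤ.- + c , + d) ≡ + (a * d + b * c)
det-I-II a b c d = begin
  + a ℤ.* + d ℤ.- + b ℤ.* ℤ.- + c   ≡⟨ identity (+ a) (+ b) (+ c) (+ d) ⟩
  + a ℤ.* + d ℤ.+ + b ℤ.* + c       ≡⟨ cong₂ ℤ._+_ (ℤ.pos-* a d) (ℤ.pos-* b c) ⟨
  + (a * d) ℤ.+ + (b * c)           ∎
  where
  open ≡-Reasoning
  identity : ∀ a b c d → a ℤ.* d ℤ.- b ℤ.* ℤ.- c ≡ a ℤ.* d ℤ.+ b ℤ.* c
  identity = ℤ-solve-∀

det-IV-I : ∀ a b c d → det (+ a , ℤ.- + b) (+ c , + d) ≡ + (a * d + b * c)
det-IV-I a b c d = begin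
  + a ℤ.* + d ℤ.- ℤ.- + b ℤ.* + c   ≡⟨ identity (+ a) (+ b) (+ c) (+ d) ⟩
  + a ℤ.* + d ℤ.+ + b ℤ.* + c       ≡⟨ cong₂ ℤ._+_ (ℤ.pos-* a d) (ℤ.pos-* b c) ⟨
  + (a * d) ℤ.+ + (b * c)           ∎
  where
  open ≡-Reasoning
  identity : ∀ a b c d → a ℤ.* d ℤ.- ℤ.- b ℤ.* c ≡ a ℤ.* d ℤ.+ b ℤ.* c
  identity = ℤ-solve-∀

∣det-I-I∣ : ∀ a b c d → b * c ≤ a * d → ∣ det (+ a , + b) (+ c , + d) ∣ ≡ a * d ∸ b * c
∣det-I-I∣ a b c d bc≤ad = cong ∣_∣ (begin
  + a ℤ.* + d ℤ.- + b ℤ.* + c   ≡⟨ cong₂ ℤ._-_ (ℤ.pos-* a d) (ℤ.pos-* b c) ⟨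
  + (a * d) ℤ.- + (b * c)       ≡⟨ ℤ.m-n≡m⊖n (a * d) (b * c) ⟩
  a * d ⊖ b * c                 ≡⟨ ℤ.⊖-≥ bc≤ad ⟩
  + (a * d ∸ b * c)             ∎)
  where open ≡-Reasoning

Symmetric : (ℤ² → Set) → Set
Symmetric S = ∀ {x} → S x → S (-ᵛ x)

DetBounded : ℕ → (ℤ² → Set) → Set
DetBounded Δ S = ∀ {x y} → S x → S y → ∣ det x y ∣ ≤ Δ

InBox : ℕ → ℕ → (ℤ² → Set) → Set
InBox m μ S = ∀ {x} → S x → ∣ proj₁ x ∣ ≤ m × ∣ proj₂ x ∣ ≤ μ

DetBounded-reflect : ∀ {Δ} S → DetBounded Δ S → DetBounded Δ (λ x → S (reflect x))
DetBounded-reflect {Δ} S bounded {x} {y} x∈S y∈S =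
  subst (_≤ Δ) (∣-i∣≡∣j∣ (det-reflect x y)) (bounded x∈S y∈S)

InBox-reflect : ∀ {m μ} S → InBox m μ S → InBox m μ (λ x → S (reflect x))
InBox-reflect {μ = μ} S inBox {x} x∈S =
  proj₁ (inBox x∈S) , subst (_≤ μ) (ℤ.∣-i∣≡∣i∣ (proj₂ x)) (proj₂ (inBox x∈S))

-i≤+∣i∣ : ∀ i → ℤ.- i ℤ.≤ + ∣ i ∣
-i≤+∣i∣ (+ zero)  = ℤ.≤-refl
-i≤+∣i∣ +[1+ n ]  = ℤ.-≤+
-i≤+∣i∣ -[1+ n ]  = ℤ.≤-refl

μ≤y-x⇒x≤0≤y : ∀ {m μ} x y → ∣ x ∣ ≤ m → ∣ y ∣ ≤ μ → m ≤ μ → + μ ℤ.≤ y ℤ.- x →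
  ∃₂ λ W Y → x ≡ ℤ.- + W × y ≡ + Y × μ ≤ Y + W
μ≤y-x⇒x≤0≤y {m} {μ} x -[1+ j ] ∣x∣≤m _ m≤μ μ≤y-x = contradiction μ≤y-x (ℤ.<⇒≱ (begin-strict
  -[1+ j ] ℤ.+ ℤ.- x   ≤⟨ ℤ.+-monoʳ-≤ -[1+ j ] (ℤ.≤-trans (-i≤+∣i∣ x) (+≤+ ∣x∣≤m)) ⟩
  m ⊖ suc j            <⟨ ℤ.m⊖1+n<m m (suc j) ⟩
  + m                  ≤⟨ +≤+ m≤μ ⟩
  + μ                  ∎))
  where open ℤ.≤-Reasoning
μ≤y-x⇒x≤0≤y {μ = μ} +[1+ k ] (+ Y) _ Y≤μ _ μ≤y-x = contradiction μ≤y-x (ℤ.<⇒≱ (begin-strict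
  Y ⊖ suc k   <⟨ ℤ.m⊖1+n<m Y (suc k) ⟩
  + Y         ≤⟨ +≤+ Y≤μ ⟩
  + μ         ∎))
  where open ℤ.≤-Reasoning
μ≤y-x⇒x≤0≤y (+ zero) (+ Y) _ _ _ μ≤y-x = 0 , Y , refl , refl , ℤ.drop‿+≤+ μ≤y-x
μ≤y-x⇒x≤0≤y -[1+ k ] (+ Y) _ _ _ μ≤y-x = suc k , Y , refl , refl , ℤ.drop‿+≤+ μ≤y-x

three-point-bound : ∀ {Δ m μ P Q} S {c} → DetBounded Δ S → InBox m μ S → m ≤ μ →
  S (+ m , + P) → S (+ Q , + μ) → S c → + μ ℤ.≤ proj₂ c ℤ.- proj₁ c →
  2 * (m * m) ≤ 3 * Δ
three-point-bound {Δ} {m} {μ} {P} {Q} S {c₁ , c₂} bounded inBox m≤μ a∈S b∈S c∈S μ≤c₂-c₁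
  with μ≤y-x⇒x≤0≤y c₁ c₂ (proj₁ (inBox c∈S)) (proj₂ (inBox c∈S)) m≤μ μ≤c₂-c₁
... | W , Y , refl , refl , μ≤Y+W =
  three-point-bound-ℕ m≤μ (proj₂ (inBox a∈S)) (proj₁ (inBox b∈S)) W≤m μ≤Y+W
    (subst (_≤ Δ) (∣det-I-I∣ m P Q μ PQ≤mμ) (bounded a∈S b∈S))
    (subst (_≤ Δ) (cong ∣_∣ (det-I-II m P W Y)) (bounded a∈S c∈S))
    (subst (_≤ Δ) (cong ∣_∣ (det-I-II Q μ W Y)) (bounded b∈S c∈S))
  where
  W≤m : W ≤ m
  W≤m = subst (_≤ m) (ℤ.∣-i∣≡∣i∣ (+ W)) (proj₁ (inBox c∈S))
  PQ≤mμ : P * Q ≤ m * μ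
  PQ≤mμ = subst (P * Q ≤_) (ℕ.*-comm μ m)
    (ℕ.*-mono-≤ (proj₂ (inBox a∈S)) (proj₁ (inBox b∈S)))

m*m≤∣det∣⇒bound : ∀ {Δ} S m {x y} → DetBounded Δ S → S x → S y →
  m * m ≤ ∣ det x y ∣ → 2 * (m * m) ≤ 3 * Δ
m*m≤∣det∣⇒bound S m {x} {y} bounded x∈S y∈S m²≤∣det∣ =
  ℕ.≤-trans (ℕ.*-monoˡ-≤ (m * m) (ℕ.m≤m+n 2 1))
            (ℕ.*-monoʳ-≤ 3 (ℕ.≤-trans m²≤∣det∣ (bounded {x} {y} x∈S y∈S)))

four-point-bound-normalized : ∀ {Δ m μ} S {a b c d} →
  DetBounded Δ S → InBox m μ S → Symmetric S → m ≤ μ →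
  S a → proj₁ a ≡ + m → S b → proj₂ b ≡ + μ →
  S c → + μ ℤ.≤ proj₂ c ℤ.- proj₁ c → S d → + μ ℤ.≤ proj₂ d ℤ.+ proj₁ d →
  2 * (m * m) ≤ 3 * Δ
four-point-bound-normalized S {_ , + P} {+ Q , _} {c}
  bounded inBox _ m≤μ a∈S refl b∈S refl c∈S μ≤c₂-c₁ _ _ =
  three-point-bound {P = P} {Q} S {c} bounded inBox m≤μ a∈S b∈S c∈S μ≤c₂-c₁
-- Reflecting in the first axis and negating b and d reduces this case to the previous one.
four-point-bound-normalized S {_ , -[1+ P ]} { -[1+ Q ] , _} {d = d₁ , d₂}
  bounded inBox symmetric m≤μ a∈S refl b∈S refl _ _ d∈S μ≤d₂+d₁ =
  three-point-bound {P = suc P} {suc Q} (λ x → S (reflect x)) {ℤ.- d₁ , d₂}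
    (DetBounded-reflect S bounded) (InBox-reflect S inBox) m≤μ
    a∈S (symmetric b∈S) (symmetric d∈S)
    (subst (λ z → + _ ℤ.≤ d₂ ℤ.+ z) (sym (ℤ.neg-involutive d₁)) μ≤d₂+d₁)
four-point-bound-normalized {m = m} {μ} S {_ , + P} { -[1+ Q ] , _}
  bounded _ _ m≤μ a∈S refl b∈S refl _ _ _ _ =
  m*m≤∣det∣⇒bound S m {+ m , + P} { -[1+ Q ] , + μ} bounded a∈S b∈S
    (ℕ.≤-trans (ℕ.*-monoʳ-≤ m m≤μ)
      (subst (m * μ ≤_) (sym (cong ∣_∣ (det-I-II m P (suc Q) μ))) (ℕ.m≤m+n _ _)))
four-point-bound-normalized {m = m} {μ} S {_ , -[1+ P ]} {+ Q , _}
  bounded _ _ m≤μ a∈S refl b∈S refl _ _ _ _ =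
  m*m≤∣det∣⇒bound S m {+ m , -[1+ P ]} {+ Q , + μ} bounded a∈S b∈S
    (ℕ.≤-trans (ℕ.*-monoʳ-≤ m m≤μ)
      (subst (m * μ ≤_) (sym (cong ∣_∣ (det-IV-I m (suc P) Q μ))) (ℕ.m≤m+n _ _)))

Odd : (ℤ² → ℤ) → Set
Odd f = ∀ x → f (-ᵛ x) ≡ ℤ.- f x

odd-representative : ∀ S {f x} → Symmetric S → Odd f → S x → ∃ λ y → S y × f y ≡ + ∣ f x ∣
odd-representative S {f} {x} symmetric odd x∈S with ℤ.+∣i∣≡i⊎+∣i∣≡-i (f x)
... | inj₁ fx≡∣fx∣ = x , x∈S , sym fx≡∣fx∣
... | inj₂ -fx≡∣fx∣ = -ᵛ x , symmetric x∈S , trans (odd x) (sym -fx≡∣fx∣)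

four-point-bound : ∀ {Δ m μ} S {a b c d} →
  DetBounded Δ S → InBox m μ S → Symmetric S → m ≤ μ →
  S a → ∣ proj₁ a ∣ ≡ m → S b → ∣ proj₂ b ∣ ≡ μ →
  S c → μ ≤ ∣ proj₂ c ℤ.- proj₁ c ∣ → S d → μ ≤ ∣ proj₂ d ℤ.+ proj₁ d ∣ →
  2 * (m * m) ≤ 3 * Δ
four-point-bound S bounded inBox symmetric m≤μ a∈S ∣a₁∣≡m b∈S ∣b₂∣≡μ c∈S μ≤∣c₂-c₁∣ d∈S μ≤∣d₂+d₁∣
  with odd-representative S symmetric (λ _ → refl) a∈S
     | odd-representative S symmetric (λ _ → refl) b∈S
     | odd-representative S symmetric odd-difference c∈S
     | odd-representative S symmetric odd-sum d∈S
  where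
  odd-difference : Odd (λ x → proj₂ x ℤ.- proj₁ x)
  odd-difference (x₁ , x₂) = identity x₁ x₂
    where
    identity : ∀ x₁ x₂ → ℤ.- x₂ ℤ.- ℤ.- x₁ ≡ ℤ.- (x₂ ℤ.- x₁)
    identity = ℤ-solve-∀
  odd-sum : Odd (λ x → proj₂ x ℤ.+ proj₁ x)
  odd-sum (x₁ , x₂) = sym (ℤ.neg-distrib-+ x₂ x₁)
... | a′ , a′∈S , a′₁≡m | b′ , b′∈S , b′₂≡μ | c′ , c′∈S , c′≡∣c∣ | d′ , d′∈S , d′≡∣d∣ =
  four-point-bound-normalized S bounded inBox symmetric m≤μ
    a′∈S (trans a′₁≡m (cong +_ ∣a₁∣≡m)) b′∈S (trans b′₂≡μ (cong +_ ∣b₂∣≡μ))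
    c′∈S (subst (_ ℤ.≤_) (sym c′≡∣c∣) (+≤+ μ≤∣c₂-c₁∣))
    d′∈S (subst (_ ℤ.≤_) (sym d′≡∣d∣) (+≤+ μ≤∣d₂+d₁∣))

record GaussReduced (N : ℤ² → ℕ) : Set where
  field
    u₁ u₂          : ℤ²
    unimodular     : ∣ det u₁ u₂ ∣ ≡ 1
    N[u₁]≤N[u₂]    : N u₁ ≤ N u₂
    N[u₂]≤N[u₂+u₁] : N u₂ ≤ N (u₂ +ᵛ u₁)
    N[u₂]≤N[u₂-u₁] : N u₂ ≤ N (u₂ -ᵛ u₁)

module _ (N : ℤ² → ℕ) where

  private
    replace-u₂ : ∀ {k u₁ u₂ w} → N u₁ + N u₂ ≤ suc k → N w < N u₂ → N u₁ + N w ≤ k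
    replace-u₂ {u₁ = u₁} N≤1+k Nw<Nu₂ = ℕ.≤-pred (ℕ.<-≤-trans (ℕ.+-monoʳ-< (N u₁) Nw<Nu₂) N≤1+k)

  reorder : ∀ k u w → N u + N w ≤ k → ∣ det u w ∣ ≡ 1 → GaussReduced N

  -- Lagrange–Gauss reduction: replace u₂ by u₂ ± u₁ while that decreases N,
  -- keeping N u₁ ≤ N u₂; the fuel k bounds N u₁ + N u₂, which strictly decreases.
  reduce : ∀ k u₁ u₂ → N u₁ + N u₂ ≤ k → ∣ det u₁ u₂ ∣ ≡ 1 → N u₁ ≤ N u₂ → GaussReduced N
  reduce zero u₁ u₂ N≤0 unimodular N[u₁]≤N[u₂] = record
    { u₁ = u₁ ; u₂ = u₂ ; unimodular = unimodular ; N[u₁]≤N[u₂] = N[u₁]≤N[u₂]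
    ; N[u₂]≤N[u₂+u₁] = N[u₂]≤ ; N[u₂]≤N[u₂-u₁] = N[u₂]≤ }
    where
    N[u₂]≤ : ∀ {n} → N u₂ ≤ n
    N[u₂]≤ = ℕ.≤-trans (ℕ.m+n≤o⇒n≤o (N u₁) N≤0) z≤n
  reduce (suc k) u₁ u₂ N≤1+k unimodular N[u₁]≤N[u₂]
    with N (u₂ +ᵛ u₁) ℕ.<? N u₂ | N (u₂ -ᵛ u₁) ℕ.<? N u₂
  ... | yes smaller | _ = reorder k u₁ (u₂ +ᵛ u₁) (replace-u₂ N≤1+k smaller)
    (trans (cong ∣_∣ (det-+ˡ-self u₁ u₂)) unimodular)
  ... | no _ | yes smaller = reorder k u₁ (u₂ -ᵛ u₁) (replace-u₂ N≤1+k smaller)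
    (trans (cong ∣_∣ (det--ˡ-self u₁ u₂)) unimodular)
  ... | no not-smaller₊ | no not-smaller₋ = record
    { u₁ = u₁ ; u₂ = u₂ ; unimodular = unimodular ; N[u₁]≤N[u₂] = N[u₁]≤N[u₂]
    ; N[u₂]≤N[u₂+u₁] = ℕ.≮⇒≥ not-smaller₊ ; N[u₂]≤N[u₂-u₁] = ℕ.≮⇒≥ not-smaller₋ }

  reorder k u w N≤k unimodular with N u ℕ.≤? N w
  ... | yes Nu≤Nw = reduce k u w N≤k unimodular Nu≤Nw
  ... | no Nu≰Nw = reduce k w u (subst (_≤ k) (ℕ.+-comm (N u) (N w)) N≤k)
    (trans (∣-i∣≡∣j∣ (det-comm u w)) unimodular) (ℕ.<⇒≤ (ℕ.≰⇒> Nu≰Nw))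

  gaussReduced : GaussReduced N
  gaussReduced = reorder _ (+ 1 , + 0) (+ 0 , + 1) ℕ.≤-refl refl

toℚᵘ-/ : ∀ i d → toℚᵘ (i ℚ./ suc d) ℚᵘ.≃ mkℚᵘ i d
toℚᵘ-/ i d = ℚ.toℚᵘ-fromℚᵘ (mkℚᵘ i d)

toℚᵘ-ι : ∀ i → toℚᵘ (ι i) ℚᵘ.≃ mkℚᵘ i 0
toℚᵘ-ι i = toℚᵘ-/ i 0

ι-+ : ∀ i j → ι (i ℤ.+ j) ≡ ι i ℚ.+ ι j
ι-+ i j = ℚ.toℚᵘ-injective (ℚᵘ.≃-trans (toℚᵘ-ι (i ℤ.+ j)) (ℚᵘ.≃-trans (*≡* (identity i j))
  (ℚᵘ.≃-sym (ℚᵘ.≃-trans (ℚ.toℚᵘ-homo-+ (ι i) (ι j)) (ℚᵘ.+-cong (toℚᵘ-ι i) (toℚᵘ-ι j))))))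
  where
  identity : ∀ i j → (i ℤ.+ j) ℤ.* + 1 ≡ (i ℤ.* + 1 ℤ.+ j ℤ.* + 1) ℤ.* + 1
  identity = ℤ-solve-∀

ι-* : ∀ i j → ι (i ℤ.* j) ≡ ι i ℚ.* ι j
ι-* i j = ℚ.toℚᵘ-injective (ℚᵘ.≃-trans (toℚᵘ-ι (i ℤ.* j))
  (ℚᵘ.≃-sym (ℚᵘ.≃-trans (ℚ.toℚᵘ-homo-* (ι i) (ι j)) (ℚᵘ.*-cong (toℚᵘ-ι i) (toℚᵘ-ι j)))))

ι-neg : ∀ i → ι (ℤ.- i) ≡ ℚ.- ι i
ι-neg i = ℚ.toℚᵘ-injective (ℚᵘ.≃-trans (toℚᵘ-ι (ℤ.- i))
  (ℚᵘ.≃-sym (ℚᵘ.≃-trans (ℚ.toℚᵘ-homo‿- (ι i)) (ℚᵘ.-‿cong (toℚᵘ-ι i)))))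

ι-mono-≤ : ∀ {i j} → i ℤ.≤ j → ι i ℚ.≤ ι j
ι-mono-≤ {i} {j} i≤j = ℚ.toℚᵘ-cancel-≤
  (ℚᵘ.≤-respʳ-≃ (ℚᵘ.≃-sym (toℚᵘ-ι j)) (ℚᵘ.≤-respˡ-≃ (ℚᵘ.≃-sym (toℚᵘ-ι i))
    (*≤* (subst₂ ℤ._≤_ (sym (ℤ.*-identityʳ i)) (sym (ℤ.*-identityʳ j)) i≤j))))

sumℚ-cong : ∀ {k} {f g : Fin k → ℚ} → (∀ i → f i ≡ g i) → sumℚ f ≡ sumℚ g
sumℚ-cong {zero}  f≡g = refl
sumℚ-cong {suc k} f≡g = cong₂ ℚ._+_ (f≡g fzero) (sumℚ-cong (λ i → f≡g (fsuc i)))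

sumℚ-+ : ∀ {k} (f g : Fin k → ℚ) → sumℚ f ℚ.+ sumℚ g ≡ sumℚ (λ i → f i ℚ.+ g i)
sumℚ-+ {zero}  f g = refl
sumℚ-+ {suc k} f g =
  trans (interchange (f fzero) (sumℚ (λ i → f (fsuc i))) (g fzero) (sumℚ (λ i → g (fsuc i))))
  (cong ((f fzero ℚ.+ g fzero) ℚ.+_) (sumℚ-+ (λ i → f (fsuc i)) (λ i → g (fsuc i))))
  where
  open +-*-Solver
  interchange : ∀ a b c d → (a ℚ.+ b) ℚ.+ (c ℚ.+ d) ≡ (a ℚ.+ c) ℚ.+ (b ℚ.+ d)
  interchange = solve 4 (λ a b c d → (a :+ b) :+ (c :+ d) := (a :+ c) :+ (b :+ d)) refl

sumℚ-*ʳ : ∀ {k} (f : Fin k → ℚ) c → sumℚ f ℚ.* c ≡ sumℚ (λ i → f i ℚ.* c)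
sumℚ-*ʳ {zero}  f c = ℚ.*-zeroˡ c
sumℚ-*ʳ {suc k} f c = trans (ℚ.*-distribʳ-+ c (f fzero) (sumℚ (λ i → f (fsuc i))))
  (cong ((f fzero ℚ.* c) ℚ.+_) (sumℚ-*ʳ (λ i → f (fsuc i)) c))

sumℚ-mono-≤ : ∀ {k} {f g : Fin k → ℚ} → (∀ i → f i ℚ.≤ g i) → sumℚ f ℚ.≤ sumℚ g
sumℚ-mono-≤ {zero}  f≤g = ℚ.≤-refl
sumℚ-mono-≤ {suc k} f≤g = ℚ.+-mono-≤ (f≤g fzero) (sumℚ-mono-≤ (λ i → f≤g (fsuc i)))

convex-combination-bounds : ∀ {k} (λs t : Fin k → ℚ) {lo hi} →
  (∀ i → 0ℚ ℚ.≤ λs i) → sumℚ λs ≡ 1ℚ → (∀ i → lo ℚ.≤ t i × t i ℚ.≤ hi) →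
  lo ℚ.≤ sumℚ (λ i → λs i ℚ.* t i) × sumℚ (λ i → λs i ℚ.* t i) ℚ.≤ hi
convex-combination-bounds λs t {lo} {hi} λs≥0 ∑λs≡1 t-bounds =
  subst (ℚ._≤ _) (constant lo) (sumℚ-mono-≤ (λ i → scale i (proj₁ (t-bounds i)))) ,
  subst (_ ℚ.≤_) (constant hi) (sumℚ-mono-≤ (λ i → scale i (proj₂ (t-bounds i))))
  where
  constant : ∀ c → sumℚ (λ i → λs i ℚ.* c) ≡ c
  constant c = trans (sym (sumℚ-*ʳ λs c)) (trans (cong (ℚ._* c) ∑λs≡1) (ℚ.*-identityˡ c))
  scale : ∀ i {p q} → p ℚ.≤ q → λs i ℚ.* p ℚ.≤ λs i ℚ.* q
  scale i = ℚ.*-monoˡ-≤-nonNeg (λs i) {{ℚ.nonNegative (λs≥0 i)}}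

perp : ℤ² → ℤ²
perp u = proj₂ u , ℤ.- proj₁ u

dot-perp-sum : ∀ {k} (S : Fin k → ℤ²) u (λs : Fin k → ℚ) →
  dot (sumℚ (λ i → λs i ℚ.* ι (proj₁ (S i))) , sumℚ (λ i → λs i ℚ.* ι (proj₂ (S i)))) (perp u)
    ≡ sumℚ (λ i → λs i ℚ.* ι (det (S i) u))
dot-perp-sum S (u₁ , u₂) λs = begin
  sumℚ (λ i → λs i ℚ.* ι (proj₁ (S i))) ℚ.* ι u₂ ℚ.+ sumℚ (λ i → λs i ℚ.* ι (proj₂ (S i))) ℚ.* ι (ℤ.- u₁)
    ≡⟨ cong₂ ℚ._+_ (sumℚ-*ʳ (λ i → λs i ℚ.* ι (proj₁ (S i))) (ι u₂))
                   (sumℚ-*ʳ (λ i → λs i ℚ.* ι (proj₂ (S i))) (ι (ℤ.- u₁))) ⟩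
  sumℚ (λ i → λs i ℚ.* ι (proj₁ (S i)) ℚ.* ι u₂) ℚ.+ sumℚ (λ i → λs i ℚ.* ι (proj₂ (S i)) ℚ.* ι (ℤ.- u₁))
    ≡⟨ sumℚ-+ (λ i → λs i ℚ.* ι (proj₁ (S i)) ℚ.* ι u₂) (λ i → λs i ℚ.* ι (proj₂ (S i)) ℚ.* ι (ℤ.- u₁)) ⟩
  sumℚ (λ i → λs i ℚ.* ι (proj₁ (S i)) ℚ.* ι u₂ ℚ.+ λs i ℚ.* ι (proj₂ (S i)) ℚ.* ι (ℤ.- u₁))
    ≡⟨ sumℚ-cong (λ i → termwise (λs i) (S i)) ⟩
  sumℚ (λ i → λs i ℚ.* ι (det (S i) (u₁ , u₂))) ∎
  where
  open ≡-Reasoning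
  open +-*-Solver
  factor : ∀ l a₁ a₂ v₁ v₂ →
    l ℚ.* a₁ ℚ.* v₂ ℚ.+ l ℚ.* a₂ ℚ.* (ℚ.- v₁) ≡ l ℚ.* (a₁ ℚ.* v₂ ℚ.+ ℚ.- (a₂ ℚ.* v₁))
  factor = solve 5 (λ l a₁ a₂ v₁ v₂ →
    l :* a₁ :* v₂ :+ l :* a₂ :* (:- v₁) := l :* (a₁ :* v₂ :+ :- (a₂ :* v₁))) refl
  termwise : ∀ l a →
    l ℚ.* ι (proj₁ a) ℚ.* ι u₂ ℚ.+ l ℚ.* ι (proj₂ a) ℚ.* ι (ℤ.- u₁) ≡ l ℚ.* ι (det a (u₁ , u₂))
  termwise l (a₁ , a₂) = begin
    l ℚ.* ι a₁ ℚ.* ι u₂ ℚ.+ l ℚ.* ι a₂ ℚ.* ι (ℤ.- u₁)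
      ≡⟨ cong (λ z → l ℚ.* ι a₁ ℚ.* ι u₂ ℚ.+ l ℚ.* ι a₂ ℚ.* z) (ι-neg u₁) ⟩
    l ℚ.* ι a₁ ℚ.* ι u₂ ℚ.+ l ℚ.* ι a₂ ℚ.* (ℚ.- ι u₁)
      ≡⟨ factor l (ι a₁) (ι a₂) (ι u₁) (ι u₂) ⟩
    l ℚ.* (ι a₁ ℚ.* ι u₂ ℚ.+ ℚ.- (ι a₂ ℚ.* ι u₁))
      ≡⟨ cong (l ℚ.*_) ι-det ⟨
    l ℚ.* ι (a₁ ℤ.* u₂ ℤ.- a₂ ℤ.* u₁)
      ∎
    where
    ι-det : ι (a₁ ℤ.* u₂ ℤ.- a₂ ℤ.* u₁) ≡ ι a₁ ℚ.* ι u₂ ℚ.+ ℚ.- (ι a₂ ℚ.* ι u₁)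
    ι-det = trans (ι-+ (a₁ ℤ.* u₂) (ℤ.- (a₂ ℤ.* u₁)))
      (cong₂ ℚ._+_ (ι-* a₁ u₂) (trans (ι-neg (a₂ ℤ.* u₁)) (cong ℚ.-_ (ι-* a₂ u₁))))

∣i∣≤n⇒-n≤i≤n : ∀ {i n} → ∣ i ∣ ≤ n → ℤ.- + n ℤ.≤ i × i ℤ.≤ + n
∣i∣≤n⇒-n≤i≤n {+ _}      {zero}  i≤n       = +≤+ z≤n , +≤+ i≤n
∣i∣≤n⇒-n≤i≤n {+ _}      {suc n} i≤n       = ℤ.-≤+ , +≤+ i≤n
∣i∣≤n⇒-n≤i≤n { -[1+ _ ]} {suc n} (s≤s i≤n) = ℤ.-≤- i≤n , ℤ.-≤+

InConv⇒dot-perp-bounds : ∀ {k} (S : Fin k → ℤ²) u M → (∀ i → ∣ det (S i) u ∣ ≤ M) →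
  ∀ {x} → InConv S x → ℚ.- ι (+ M) ℚ.≤ dot x (perp u) × dot x (perp u) ℚ.≤ ι (+ M)
InConv⇒dot-perp-bounds S u M ∣det∣≤M (λs , λs≥0 , ∑λs≡1 , refl , refl) =
  subst (λ z → ℚ.- ι (+ M) ℚ.≤ z × z ℚ.≤ ι (+ M)) (sym (dot-perp-sum S u λs))
    (convex-combination-bounds λs (λ i → ι (det (S i) u)) λs≥0 ∑λs≡1 det-bounds)
  where
  det-bounds : ∀ i → ℚ.- ι (+ M) ℚ.≤ ι (det (S i) u) × ι (det (S i) u) ℚ.≤ ι (+ M)
  det-bounds i with ∣i∣≤n⇒-n≤i≤n (∣det∣≤M i)
  ... | lower , upper =
    subst (ℚ._≤ ι (det (S i) u)) (ι-neg (+ M)) (ι-mono-≤ {ℤ.- + M} {det (S i) u} lower) ,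
    ι-mono-≤ {det (S i) u} {+ M} upper

leibnizTerm-odd : ∀ n → leibnizTerm (suc (2 * n)) ≡ ℚ.- (+ 4 ℚ./ suc (2 * suc (2 * n)))
leibnizTerm-odd n with suc (2 * n) % 2 | odd
  where
  odd : suc (2 * n) % 2 ≡ 1
  odd = trans (cong (λ k → suc k % 2) (ℕ.*-comm 2 n)) ([m+kn]%n≡m%n 1 n 2)
... | _ | refl = refl

leibnizTerm-even : ∀ n → leibnizTerm (suc (suc (2 * n))) ≡ + 4 ℚ./ suc (2 * suc (suc (2 * n)))
leibnizTerm-even n with suc (suc (2 * n)) % 2 | even
  where
  even : suc (suc (2 * n)) % 2 ≡ 0
  even = trans (cong (λ k → suc (suc k) % 2) (ℕ.*-comm 2 n)) ([m+kn]%n≡m%n 2 n 2)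
... | _ | refl = refl

piUpper-suc : ∀ n → piUpper (suc n) ≡
  piUpper n ℚ.- (+ 4 ℚ./ suc (2 * suc (2 * n))) ℚ.+ (+ 4 ℚ./ suc (2 * suc (suc (2 * n))))
piUpper-suc n = begin
  leibniz (suc (2 * suc n))
    ≡⟨ cong (λ k → leibniz (suc k)) (ℕ.*-suc 2 n) ⟩
  piUpper n ℚ.+ leibnizTerm (suc (2 * n)) ℚ.+ leibnizTerm (suc (suc (2 * n)))
    ≡⟨ cong₂ (λ s t → piUpper n ℚ.+ s ℚ.+ t) (leibnizTerm-odd n) (leibnizTerm-even n) ⟩
  piUpper n ℚ.- (+ 4 ℚ./ suc (2 * suc (2 * n))) ℚ.+ (+ 4 ℚ./ suc (2 * suc (suc (2 * n)))) ∎
  where open ≡-Reasoning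

1/[2n+3]+4/[4n+3]≤1/[2n+1]+4/[4n+5] : ∀ n →
  (+ 1 ℚ./ suc (2 * suc n)) ℚ.+ (+ 4 ℚ./ suc (2 * suc (2 * n)))
    ℚ.≤ (+ 1 ℚ./ suc (2 * n)) ℚ.+ (+ 4 ℚ./ suc (2 * suc (suc (2 * n))))
1/[2n+3]+4/[4n+3]≤1/[2n+1]+4/[4n+5] n = ℚ.toℚᵘ-cancel-≤
  (ℚᵘ.≤-respˡ-≃ (ℚᵘ.≃-sym (toℚᵘ-sum 1 B 4 C)) (ℚᵘ.≤-respʳ-≃ (ℚᵘ.≃-sym (toℚᵘ-sum 1 D 4 E))
    (*≤* (subst₂ ℤ._≤_ (sym (cross 1 C 4 B (suc D * suc E))) (sym (cross 1 E 4 D (suc B * suc C)))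
      (+≤+ (ℕ.≤-trans (ℕ.m≤m+n _ 6) (ℕ.≤-reflexive (polynomial n))))))))
  where
  B = 2 * suc n
  C = 2 * suc (2 * n)
  D = 2 * n
  E = 2 * suc (suc (2 * n))
  toℚᵘ-sum : ∀ a b c d →
    toℚᵘ ((+ a ℚ./ suc b) ℚ.+ (+ c ℚ./ suc d)) ℚᵘ.≃ mkℚᵘ (+ a) b ℚᵘ.+ mkℚᵘ (+ c) d
  toℚᵘ-sum a b c d = ℚᵘ.≃-trans (ℚ.toℚᵘ-homo-+ (+ a ℚ./ suc b) (+ c ℚ./ suc d))
    (ℚᵘ.+-cong (toℚᵘ-/ (+ a) b) (toℚᵘ-/ (+ c) d))
  cross : ∀ a b c d e →
    (+ a ℤ.* + suc b ℤ.+ + c ℤ.* + suc d) ℤ.* + e ≡ + ((a * suc b + c * suc d) * e)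
  cross a b c d e =
    trans (cong (ℤ._* + e) (cong₂ ℤ._+_ (sym (ℤ.pos-* a (suc b))) (sym (ℤ.pos-* c (suc d)))))
          (sym (ℤ.pos-* (a * suc b + c * suc d) e))
  -- Cross-multiplied, the right-hand side exceeds the left-hand side by exactly 6.
  polynomial : ∀ n →
    (1 * suc (2 * suc (2 * n)) + 4 * suc (2 * suc n)) * (suc (2 * n) * suc (2 * suc (suc (2 * n)))) + 6
      ≡ (1 * suc (2 * suc (suc (2 * n))) + 4 * suc (2 * n)) * (suc (2 * suc n) * suc (2 * suc (2 * n)))
  polynomial = solve-∀

3+1/[2n+1]≤piUpper : ∀ n → ι (+ 3) ℚ.+ (+ 1 ℚ./ suc (2 * n)) ℚ.≤ piUpper n
3+1/[2n+1]≤piUpper zero = ℚ.≤-refl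
3+1/[2n+1]≤piUpper (suc n) = begin
  T ℚ.+ x′                        ≡⟨ regroup₁ T x′ A ⟩
  T ℚ.+ (x′ ℚ.+ A) ℚ.- A
    ≤⟨ ℚ.+-monoˡ-≤ (ℚ.- A) (ℚ.+-monoʳ-≤ T (1/[2n+3]+4/[4n+3]≤1/[2n+1]+4/[4n+5] n)) ⟩
  T ℚ.+ (x ℚ.+ E) ℚ.- A           ≡⟨ regroup₂ T x E A ⟩
  (T ℚ.+ x) ℚ.+ (ℚ.- A ℚ.+ E)     ≤⟨ ℚ.+-monoˡ-≤ (ℚ.- A ℚ.+ E) (3+1/[2n+1]≤piUpper n) ⟩
  piUpper n ℚ.+ (ℚ.- A ℚ.+ E)     ≡⟨ ℚ.+-assoc (piUpper n) (ℚ.- A) E ⟨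
  piUpper n ℚ.- A ℚ.+ E           ≡⟨ piUpper-suc n ⟨
  piUpper (suc n)                 ∎
  where
  open ℚ.≤-Reasoning
  open +-*-Solver
  T = ι (+ 3)
  x′ = + 1 ℚ./ suc (2 * suc n)
  x = + 1 ℚ./ suc (2 * n)
  A = + 4 ℚ./ suc (2 * suc (2 * n))
  E = + 4 ℚ./ suc (2 * suc (suc (2 * n)))
  regroup₁ : ∀ T x′ A → T ℚ.+ x′ ≡ T ℚ.+ (x′ ℚ.+ A) ℚ.- A
  regroup₁ = solve 3 (λ T x′ A → T :+ x′ := T :+ (x′ :+ A) :+ :- A) refl
  regroup₂ : ∀ T x E A → T ℚ.+ (x ℚ.+ E) ℚ.- A ≡ (T ℚ.+ x) ℚ.+ (ℚ.- A ℚ.+ E)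
  regroup₂ = solve 4 (λ T x E A → T :+ (x :+ E) :+ :- A := (T :+ x) :+ (:- A :+ E)) refl

3≤piUpper : ∀ n → ι (+ 3) ℚ.≤ piUpper n
3≤piUpper n = begin
  ι (+ 3)                              ≡⟨ ℚ.+-identityʳ (ι (+ 3)) ⟨
  ι (+ 3) ℚ.+ 0ℚ                       ≤⟨ ℚ.+-monoʳ-≤ (ι (+ 3)) 0≤1/[2n+1] ⟩
  ι (+ 3) ℚ.+ (+ 1 ℚ./ suc (2 * n))    ≤⟨ 3+1/[2n+1]≤piUpper n ⟩
  piUpper n                            ∎
  where
  open ℚ.≤-Reasoning
  0≤1/[2n+1] : 0ℚ ℚ.≤ + 1 ℚ./ suc (2 * n)
  0≤1/[2n+1] = ℚ.nonNegative⁻¹ (+ 1 ℚ./ suc (2 * n)) {{ℚ.normalize-nonNeg 1 (suc (2 * n))}}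

0≤d≤B⇒d*d≤B*B : ∀ {B d} → 0ℚ ℚ.≤ d → d ℚ.≤ B → d ℚ.* d ℚ.≤ B ℚ.* B
0≤d≤B⇒d*d≤B*B {B} {d} 0≤d d≤B =
  ℚ.≤-trans (ℚ.*-monoˡ-≤-nonNeg d {{ℚ.nonNegative 0≤d}} d≤B)
            (ℚ.*-monoʳ-≤-nonNeg B {{ℚ.nonNegative (ℚ.≤-trans 0≤d d≤B)}} d≤B)

-B≤d≤B⇒d*d≤B*B : ∀ {B d} → ℚ.- B ℚ.≤ d → d ℚ.≤ B → d ℚ.* d ℚ.≤ B ℚ.* B
-B≤d≤B⇒d*d≤B*B {B} {d} -B≤d d≤B with ℚ.≤-total 0ℚ d
... | inj₁ 0≤d = 0≤d≤B⇒d*d≤B*B 0≤d d≤B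
... | inj₂ d≤0 = subst (ℚ._≤ B ℚ.* B) (neg-square d)
  (0≤d≤B⇒d*d≤B*B (ℚ.neg-antimono-≤ d≤0) (subst (ℚ.- d ℚ.≤_) (neg-involutive B) (ℚ.neg-antimono-≤ -B≤d)))
  where
  open +-*-Solver
  neg-square : ∀ d → ℚ.- d ℚ.* ℚ.- d ≡ d ℚ.* d
  neg-square = solve 1 (λ d → :- d :* :- d := d :* d) refl
  neg-involutive : ∀ B → ℚ.- (ℚ.- B) ≡ B
  neg-involutive = solve 1 (λ B → :- (:- B) := B) refl

-B≤p,q≤B⇒[p-q]²≤[B+B]² : ∀ {B p q} → ℚ.- B ℚ.≤ p → p ℚ.≤ B → ℚ.- B ℚ.≤ q → q ℚ.≤ B →
  (p ℚ.- q) ℚ.* (p ℚ.- q) ℚ.≤ (B ℚ.+ B) ℚ.* (B ℚ.+ B)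
-B≤p,q≤B⇒[p-q]²≤[B+B]² {B} -B≤p p≤B -B≤q q≤B = -B≤d≤B⇒d*d≤B*B
  (subst (ℚ._≤ _) (neg-double B) (ℚ.+-mono-≤ -B≤p (ℚ.neg-antimono-≤ q≤B)))
  (ℚ.+-mono-≤ p≤B (subst (_ ℚ.≤_) (neg-involutive B) (ℚ.neg-antimono-≤ -B≤q)))
  where
  open +-*-Solver
  neg-double : ∀ B → ℚ.- B ℚ.+ ℚ.- B ≡ ℚ.- (B ℚ.+ B)
  neg-double = solve 1 (λ B → :- B :+ :- B := :- (B :+ B)) refl
  neg-involutive : ∀ B → ℚ.- (ℚ.- B) ≡ B
  neg-involutive = solve 1 (λ B → :- (:- B) := B) refl

2m²≤3Δ⇒[m+m]²≤π·2Δ : ∀ m Δ → 2 * (m * m) ≤ 3 * Δ →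
  ((ι (+ m) ℚ.+ ι (+ m)) ℚ.* (ι (+ m) ℚ.+ ι (+ m))) ≤π· ι (+ (2 * Δ))
2m²≤3Δ⇒[m+m]²≤π·2Δ m Δ 2m²≤3Δ n = begin
  (ι (+ m) ℚ.+ ι (+ m)) ℚ.* (ι (+ m) ℚ.+ ι (+ m))
    ≡⟨ cong₂ ℚ._*_ (ι-+ (+ m) (+ m)) (ι-+ (+ m) (+ m)) ⟨
  ι (+ m ℤ.+ + m) ℚ.* ι (+ m ℤ.+ + m)
    ≡⟨ ι-* (+ m ℤ.+ + m) (+ m ℤ.+ + m) ⟨
  ι ((+ m ℤ.+ + m) ℤ.* (+ m ℤ.+ + m))
    ≤⟨ ι-mono-≤ {(+ m ℤ.+ + m) ℤ.* (+ m ℤ.+ + m)} {+ 3 ℤ.* + (2 * Δ)} [m+m]²≤3·2Δ ⟩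
  ι (+ 3 ℤ.* + (2 * Δ))
    ≡⟨ ι-* (+ 3) (+ (2 * Δ)) ⟩
  ι (+ 3) ℚ.* ι (+ (2 * Δ))
    ≤⟨ ℚ.*-monoʳ-≤-nonNeg (ι (+ (2 * Δ))) {{2Δ≥0}} (3≤piUpper n) ⟩
  piUpper n ℚ.* ι (+ (2 * Δ))
    ∎
  where
  open ℚ.≤-Reasoning
  2Δ≥0 : ℚ.NonNegative (ι (+ (2 * Δ)))
  2Δ≥0 = ℚ.nonNegative (ι-mono-≤ {+ 0} {+ (2 * Δ)} (+≤+ z≤n))
  [m+m]²≤3·2Δ : (+ m ℤ.+ + m) ℤ.* (+ m ℤ.+ + m) ℤ.≤ + 3 ℤ.* + (2 * Δ)
  [m+m]²≤3·2Δ = subst₂ ℤ._≤_ (ℤ.pos-* (m + m) (m + m)) (ℤ.pos-* 3 (2 * Δ))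
    (+≤+ (subst₂ _≤_ (sym (four-squares m)) (regroup Δ) (ℕ.*-monoʳ-≤ 2 2m²≤3Δ)))
    where
    four-squares : ∀ m → (m + m) * (m + m) ≡ 2 * (2 * (m * m))
    four-squares = solve-∀
    regroup : ∀ Δ → 2 * (3 * Δ) ≡ 3 * (2 * Δ)
    regroup = solve-∀

argmaxᶠ : ∀ {k} → (Fin (suc k) → ℕ) → Fin (suc k)
argmaxᶠ f = argmax f fzero (allFin _)

maxᶠ : ∀ {k} → (Fin (suc k) → ℕ) → ℕ
maxᶠ f = f (argmaxᶠ f)

≤-maxᶠ : ∀ {k} (f : Fin (suc k) → ℕ) i → f i ≤ maxᶠ f
≤-maxᶠ f i = All.lookup (f[xs]≤f[argmax] {f = f} fzero (allFin _)) (∈-allFin i)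

±-image : ∀ {n} → (Fin n → ℤ²) → ℤ² → Set
±-image f x = ∃ λ i → x ≡ f i ⊎ x ≡ -ᵛ f i

±-image-symmetric : ∀ {n} (f : Fin n → ℤ²) → Symmetric (±-image f)
±-image-symmetric f (i , inj₁ refl) = i , inj₂ refl
±-image-symmetric f (i , inj₂ refl) = i , inj₁ (-ᵛ-involutive (f i))

±-image-DetBounded : ∀ {n Δ} (f : Fin n → ℤ²) → (∀ i j → ∣ det (f i) (f j) ∣ ≤ Δ) →
  DetBounded Δ (±-image f)
±-image-DetBounded {Δ = Δ} f bound {x} {y} (i , x≡±fi) (j , y≡±fj) =
  subst (_≤ Δ) (sym (trans (∣det∣-±ˡ y x≡±fi) (∣det∣-±ʳ (f i) y≡±fj))) (bound i j)
  where
  ∣det∣-±ˡ : ∀ {x z} y → x ≡ z ⊎ x ≡ -ᵛ z → ∣ det x y ∣ ≡ ∣ det z y ∣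
  ∣det∣-±ˡ y (inj₁ refl) = refl
  ∣det∣-±ˡ {z = z} y (inj₂ refl) = ∣-i∣≡∣j∣ (det-negˡ z y)
  ∣det∣-±ʳ : ∀ x {y z} → y ≡ z ⊎ y ≡ -ᵛ z → ∣ det x y ∣ ≡ ∣ det x z ∣
  ∣det∣-±ʳ x (inj₁ refl) = refl
  ∣det∣-±ʳ x {z = z} (inj₂ refl) = ∣-i∣≡∣j∣ (det-negʳ x z)

±-image-InBox : ∀ {n m μ} (f : Fin n → ℤ²) →
  (∀ i → ∣ proj₁ (f i) ∣ ≤ m × ∣ proj₂ (f i) ∣ ≤ μ) → InBox m μ (±-image f)
±-image-InBox f inBox (i , inj₁ refl) = inBox i
±-image-InBox {m = m} {μ} f inBox (i , inj₂ refl) =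
  subst (_≤ m) (sym (ℤ.∣-i∣≡∣i∣ (proj₁ (f i)))) (proj₁ (inBox i)) ,
  subst (_≤ μ) (sym (ℤ.∣-i∣≡∣i∣ (proj₂ (f i)))) (proj₂ (inBox i))

symm-det-bounded : ∀ {n} (A : PointSet n) u M → (∀ i → ∣ det (A i) u ∣ ≤ M) →
  ∀ j → ∣ det (symm A j) u ∣ ≤ M
symm-det-bounded {n} A u M bound j with splitAt n j
... | inj₁ i = bound i
... | inj₂ i = subst (_≤ M) (sym (∣-i∣≡∣j∣ (det-negˡ (A i) u))) (bound i)

unimodular⇒perp≢0 : ∀ {u w} → ∣ det u w ∣ ≡ 1 → perp u ≢ (+ 0 , + 0)
unimodular⇒perp≢0 {u₁ , u₂} unimodular perp≡0
  with ℤ.neg-injective {u₁} {+ 0} (cong proj₂ perp≡0) | cong proj₁ perp≡0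
... | refl | refl = ℕ.0≢1+n unimodular

module _ {k Δ} (A : PointSet (suc k)) (A-bounded : ∀ i j → ∣ det (A i) (A j) ∣ ≤ Δ) where

  halfWidth : ℤ² → ℕ
  halfWidth u = maxᶠ (λ i → ∣ det (A i) u ∣)

  module _ (reduced : GaussReduced halfWidth) where

    open GaussReduced reduced

    2·halfWidth[u₁]²≤3Δ : 2 * (halfWidth u₁ * halfWidth u₁) ≤ 3 * Δ
    2·halfWidth[u₁]²≤3Δ =
      four-point-bound (±-image points) {point u₁} {point u₂} {point (u₂ -ᵛ u₁)} {point (u₂ +ᵛ u₁)}
        (±-image-DetBounded points points-bounded) (±-image-InBox points points-inBox)
        (±-image-symmetric points) N[u₁]≤N[u₂]
        (extremal u₁ , inj₁ refl) refl
        (extremal u₂ , inj₁ refl) refl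
        (extremal (u₂ -ᵛ u₁) , inj₁ refl)
          (subst (halfWidth u₂ ≤_) (cong ∣_∣ (det--ʳ (A (extremal (u₂ -ᵛ u₁))) u₂ u₁)) N[u₂]≤N[u₂-u₁])
        (extremal (u₂ +ᵛ u₁) , inj₁ refl)
          (subst (halfWidth u₂ ≤_) (cong ∣_∣ (det-+ʳ (A (extremal (u₂ +ᵛ u₁))) u₂ u₁)) N[u₂]≤N[u₂+u₁])
      where
      points : Fin (suc k) → ℤ²
      points i = coordinates u₁ u₂ (A i)
      extremal : ℤ² → Fin (suc k)
      extremal u = argmaxᶠ (λ i → ∣ det (A i) u ∣)
      point : ℤ² → ℤ²
      point u = points (extremal u)
      points-bounded : ∀ i j → ∣ det (points i) (points j) ∣ ≤ Δ
      points-bounded i j = subst (_≤ Δ) (sym (begin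
        ∣ det (points i) (points j) ∣             ≡⟨ cong ∣_∣ (det-coordinates u₁ u₂ (A i) (A j)) ⟩
        ∣ det (A i) (A j) ℤ.* det u₁ u₂ ∣         ≡⟨ ℤ.abs-* (det (A i) (A j)) (det u₁ u₂) ⟩
        ∣ det (A i) (A j) ∣ * ∣ det u₁ u₂ ∣       ≡⟨ cong (∣ det (A i) (A j) ∣ *_) unimodular ⟩
        ∣ det (A i) (A j) ∣ * 1                   ≡⟨ ℕ.*-identityʳ ∣ det (A i) (A j) ∣ ⟩
        ∣ det (A i) (A j) ∣                       ∎)) (A-bounded i j)
        where open ≡-Reasoning
      points-inBox : ∀ i → ∣ proj₁ (points i) ∣ ≤ halfWidth u₁ × ∣ proj₂ (points i) ∣ ≤ halfWidth u₂
      points-inBox i = ≤-maxᶠ (λ j → ∣ det (A j) u₁ ∣) i , ≤-maxᶠ (λ j → ∣ det (A j) u₂ ∣) i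

    reduced⇒LatticeWidthBound : LatticeWidthBound A Δ
    reduced⇒LatticeWidthBound = perp u₁ , unimodular⇒perp≢0 unimodular , λ x y x∈Q y∈Q n →
      let x-lower , x-upper = dot-perp-bounds x∈Q
          y-lower , y-upper = dot-perp-bounds y∈Q in
      ℚ.≤-trans (-B≤p,q≤B⇒[p-q]²≤[B+B]² x-lower x-upper y-lower y-upper)
                (2m²≤3Δ⇒[m+m]²≤π·2Δ (halfWidth u₁) Δ 2·halfWidth[u₁]²≤3Δ n)
      where
      dot-perp-bounds : ∀ {x} → InConv (symm A) x →
        ℚ.- ι (+ halfWidth u₁) ℚ.≤ dot x (perp u₁) × dot x (perp u₁) ℚ.≤ ι (+ halfWidth u₁)
      dot-perp-bounds = InConv⇒dot-perp-bounds (symm A) u₁ (halfWidth u₁)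
        (symm-det-bounded A u₁ (halfWidth u₁) (≤-maxᶠ (λ i → ∣ det (A i) u₁ ∣)))

  latticeWidthBound : LatticeWidthBound A Δ
  latticeWidthBound = reduced⇒LatticeWidthBound (gaussReduced halfWidth)

lemma3p3 : (Δ : ℕ) → .{{_ : NonZero Δ}} → (n : ℕ) → (A : PointSet n) →
    IsModular A Δ → LatticeWidthBound A Δ
lemma3p3 Δ zero    A (_ , (() , _) , _)
lemma3p3 Δ (suc k) A (_ , _ , A-bounded) = latticeWidthBound A A-bounded
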